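{- Let $n$ and $m$ be positive integers with $m\geq n+1$. The number of pointed $(n,m)$-lattice paths $\dot{P}$ with $PNPL(\dot{P})=0$ is $\binom{m-1}{n}c_n$, where $c_n=\frac{1}{n+1}\binom{2n}{n}$.
   Context: An $(n,m)$-lattice path is a sequence $P=(x_1,y_1)(x_2,y_2)\cdots(x_{n+1},y_{n+1})$ of vectors in $\mathbb{Z}^2$ such that $1-n\leq y_i\leq 1$ for all $i$, $\sum_{i=1}^{n+1}y_i=1$, $1\leq x_i\leq m-1$ for all $i$, and $\sum_{i=1}^{n+1}x_i=m$. For such $P$, let $NP(P)=\{i\in\{1,\ldots,n+1\}\mid \sum_{j=1}^{i}y_j\leq 0\}$ and $NPL(P)=\sum_{i\in NP(P)}x_i$. A pointed $(n,m)$-lattice path is a pair $\dot{P}=[P;j]$ where $P$ is an $(n,m)$-lattice path and $j$ is an integer with $0\leq j\leq x_{n+1}-1$; its pointed non-positive length is $PNPL(\dot{P})=NPL(P)+j$. -}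

module Defs where

open import Data.Nat as ℕ using (ℕ; suc)
open import Data.Nat.Combinatorics using (_C_)
open import Data.Nat.DivMod using (_/_)
open import Data.Integer using (ℤ; +_; _+_; _-_; _≤_; _≤?_; -_)
open import Data.Product using (Σ; _×_; _,_; proj₁)
open import Data.Vec using (Vec; []; _∷_; last; foldr)
open import Data.Vec.Relation.Unary.All using (All)
open import Relation.Nullary using (does)
open import Relation.Binary.PropositionalEquality using (_≡_)
open import Data.Bool using (if_then_else_)

catalan : ℕ → ℕ
catalan n = ((2 ℕ.* n) C n) / suc n

Seq : ℕ → Set
Seq n = Vec (ℤ × ℤ) (suc n)

sumX : ∀ {k} → Vec (ℤ × ℤ) k → ℤ
sumX = foldr _ (λ { (x , y) s → x + s }) (+ 0)

sumY : ∀ {k} → Vec (ℤ × ℤ) k → ℤ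
sumY = foldr _ (λ { (x , y) s → y + s }) (+ 0)

EntryOK : ℕ → ℕ → ℤ × ℤ → Set
EntryOK n m (x , y) = ((+ 1 - + n) ≤ y × y ≤ + 1) × (+ 1 ≤ x × x ≤ + m - + 1)

IsLatticePath : (n m : ℕ) → Seq n → Set
IsLatticePath n m P = All (EntryOK n m) P × sumY P ≡ + 1 × sumX P ≡ + m

-- NPL with accumulator acc = y_1 + ... + y_{i-1}:
-- adds x_i whenever the partial sum y_1 + ... + y_i is ≤ 0
nplFrom : ∀ {k} → ℤ → Vec (ℤ × ℤ) k → ℤ
nplFrom acc [] = + 0
nplFrom acc ((x , y) ∷ P) =
  (if does (acc + y ≤? + 0) then x else + 0) + nplFrom (acc + y) P

-- NPL(P) = sum of x_i over i ∈ NP(P) = {i | y_1 + ... + y_i ≤ 0}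
NPL : ∀ {k} → Vec (ℤ × ℤ) k → ℤ
NPL = nplFrom (+ 0)

lastX : ∀ {n} → Seq n → ℤ
lastX P = proj₁ (last P)

PointedPath : ℕ → ℕ → Set
PointedPath n m =
  Σ (Seq n) λ P → IsLatticePath n m P × Σ ℤ λ j → (+ 0 ≤ j × j ≤ lastX P - + 1)

PNPL : ∀ {n m} → PointedPath n m → ℤ
PNPL (P , _ , j , _) = NPL P + j

PointedPathPNPL0 : ℕ → ℕ → Set
PointedPathPNPL0 n m = Σ (PointedPath n m) λ Ṗ → PNPL Ṗ ≡ + 0

-- Since every xᵢ ≥ 1, NPL is nonnegative, so PNPL = 0 forces the pointing j = 0 and
-- NP(P) = ∅: every partial sum of the yᵢ is positive.  Writing xᵢ = 1 + aᵢ and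
-- yᵢ = 1 − zᵢ, such a path is a pair of independent data: a weak composition a of
-- m − n − 1 into n + 1 parts, counted by C(m − 1, n), and a sequence z with Σ z = n whose
-- walk with steps 1 − zᵢ stays positive.  Decrementing the first entry of z gives a
-- Pascal-type recursion for the latter count (from any starting height h), solved by the
-- ballot numbers C(h + 2a, a) − C(h + 2a, a − 1); at h = 0 these are C(2n, n) − C(2n, n − 1) = cₙ.

module Submission where

open import Defs
open import Data.Nat using (ℕ; _≤_; _+_; _*_; _∸_)
open import Data.Nat.Combinatorics using (_C_)
open import Data.Fin using (Fin)
open import Function.Bundles using (_↔_)

open import Data.Nat using (zero; suc; _<_; _≤?_; z≤n; s≤s; s≤s⁻¹)
open import Data.Nat.Properties
open import Data.Nat.Combinatorics using (nCk≡nC[n∸k]; nCn≡1; nC1≡n; nCk+nC[k+1]≡[n+1]C[k+1])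
open import Data.Nat.DivMod using (_/_; m*n/n≡m)
open import Data.Nat.Solver using (module +-*-Solver)
open import Data.Integer as ℤ using (ℤ; +_; -[1+_]; _⊖_; +≤+)
import Data.Integer.Properties as ℤ
open import Data.Fin.Properties using (+↔⊎; *↔×)
open import Data.Vec using (Vec; []; _∷_; sum; last; zipWith; map)
open import Data.Vec.Relation.Unary.All as All using (All; []; _∷_)
open import Data.Product using (Σ; _×_; _,_; proj₁; proj₂)
open import Data.Product.Function.NonDependent.Propositional using (_×-↔_)
open import Data.Sum using (_⊎_; inj₁; inj₂)
open import Data.Sum.Function.Propositional using (_⊎-↔_)
open import Data.Unit using (⊤; tt)
open import Data.Bool using (true; false; if_then_else_)
open import Data.Empty using (⊥-elim)
open import Function using (_∘_)
open import Function.Bundles using (mk↔ₛ′)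
open import Function.Properties.Inverse using (↔-trans; ↔-sym)
open import Function.Related.Propositional using (module EquationalReasoning)
open import Relation.Nullary using (Irrelevant; does; yes; no)
open import Relation.Nullary.Decidable using (dec-true)
open import Relation.Binary.PropositionalEquality
open import Axiom.UniquenessOfIdentityProofs using (module Decidable⇒UIP)
import Algebra.Properties.CommutativeSemigroup as CommSemigroupProperties
import Algebra.Properties.AbelianGroup

open +-*-Solver using (solve; _:=_; con; _:+_; _:*_)

module ℕ+ = CommSemigroupProperties +-commutativeSemigroup
module ℤ+ = CommSemigroupProperties ℤ.+-commutativeSemigroup
module ℤ+-group = Algebra.Properties.AbelianGroup ℤ.+-0-abelianGroup

pascal : ∀ n k → suc n C suc k ≡ n C k + n C suc k
pascal n k = sym (nCk+nC[k+1]≡[n+1]C[k+1] n k)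

[1+k]*[1+n]C[1+k]≡[1+n]*nCk : ∀ n k → suc k * (suc n C suc k) ≡ suc n * (n C k)
[1+k]*[1+n]C[1+k]≡[1+n]*nCk zero    zero    = refl
[1+k]*[1+n]C[1+k]≡[1+n]*nCk zero    (suc k) = *-zeroʳ (suc (suc k))
[1+k]*[1+n]C[1+k]≡[1+n]*nCk (suc n) zero    =
  trans (+-identityʳ _) (trans (nC1≡n (suc (suc n))) (sym (*-identityʳ _)))
[1+k]*[1+n]C[1+k]≡[1+n]*nCk (suc n) (suc k) = begin
  suc (suc k) * (suc (suc n) C suc (suc k))       ≡⟨ cong (suc (suc k) *_) (pascal (suc n) (suc k)) ⟩
  suc (suc k) * (x + w)                           ≡⟨ rearrange k x w ⟩
  x + (suc k * x + suc (suc k) * w)               ≡⟨ cong (_+_ x) (cong₂ _+_ ([1+k]*[1+n]C[1+k]≡[1+n]*nCk n k)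
                                                                             ([1+k]*[1+n]C[1+k]≡[1+n]*nCk n (suc k))) ⟩
  x + (suc n * (n C k) + suc n * (n C suc k))     ≡⟨ cong (_+_ x) (sym (*-distribˡ-+ (suc n) (n C k) (n C suc k))) ⟩
  x + suc n * (n C k + n C suc k)                 ≡⟨ cong (λ y → x + suc n * y) (sym (pascal n k)) ⟩
  suc (suc n) * x                                 ∎
  where
  open ≡-Reasoning
  x = suc n C suc k
  w = suc n C suc (suc k)
  rearrange : ∀ k x w → suc (suc k) * (x + w) ≡ x + (suc k * x + suc (suc k) * w)
  rearrange = solve 3 (λ k x w → (con 2 :+ k) :* (x :+ w) := x :+ ((con 1 :+ k) :* x :+ (con 2 :+ k) :* w)) refl

[m+n]Cm≡[m+n]Cn : ∀ m n → (m + n) C m ≡ (m + n) C n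
[m+n]Cm≡[m+n]Cn m n = trans (nCk≡nC[n∸k] (m≤m+n m n)) (cong ((m + n) C_) (m+n∸m≡n m n))

[1+k]*[2+2k]C[1+k]≡[2+k]*[2+2k]Ck : ∀ k →
  suc k * ((suc k + suc k) C suc k) ≡ suc (suc k) * ((suc k + suc k) C k)
[1+k]*[2+2k]C[1+k]≡[2+k]*[2+2k]Ck k = begin
  suc k * (suc M C suc k)               ≡⟨ [1+k]*[1+n]C[1+k]≡[1+n]*nCk M k ⟩
  suc M * (M C k)                       ≡⟨ cong (suc M *_) ([m+n]Cm≡[m+n]Cn k (suc k)) ⟩
  suc M * (M C suc k)                   ≡⟨ sym ([1+k]*[1+n]C[1+k]≡[1+n]*nCk M (suc k)) ⟩
  suc (suc k) * (suc M C suc (suc k))   ≡⟨ cong (λ N → suc (suc k) * (N C suc (suc k))) (sym (+-suc k (suc k))) ⟩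
  suc (suc k) * (M′ C suc (suc k))      ≡⟨ cong (suc (suc k) *_) (sym ([m+n]Cm≡[m+n]Cn k (suc (suc k)))) ⟩
  suc (suc k) * (M′ C k)                ≡⟨ cong (λ N → suc (suc k) * (N C k)) (+-suc k (suc k)) ⟩
  suc (suc k) * (suc M C k)             ∎
  where
  open ≡-Reasoning
  M  = k + suc k
  M′ = k + suc (suc k)

-- The number of BallotSequences h a; its closed form is ballot+defect≡C.
ballot : ℕ → ℕ → ℕ
ballot h       zero    = 1
ballot zero    (suc a) = ballot 1 a
ballot (suc h) (suc a) = ballot (suc (suc h)) a + ballot h (suc a)

-- (h + 2a) C (a − 1), except 0 rather than h C 0 = 1 at a = 0.
ballotDefect : ℕ → ℕ → ℕ
ballotDefect h zero    = 0
ballotDefect h (suc a) = (h + suc a + suc a) C a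

ballotDefect-suc : ∀ h a →
  ballotDefect (suc h) (suc a) ≡ ballotDefect (suc (suc h)) a + ballotDefect h (suc a)
ballotDefect-suc h zero    = refl
ballotDefect-suc h (suc a) = begin
  suc L C suc a                                     ≡⟨ pascal L a ⟩
  L C a + L C suc a                                 ≡⟨ cong (λ N → N C a + L C suc a) (shift h a) ⟩
  (suc (suc h) + suc a + suc a) C a + L C suc a     ∎
  where
  open ≡-Reasoning
  L = h + suc (suc a) + suc (suc a)
  shift : ∀ h a → h + suc (suc a) + suc (suc a) ≡ suc (suc h) + suc a + suc a
  shift = solve 2 (λ h a → h :+ (con 2 :+ a) :+ (con 2 :+ a) := con 2 :+ h :+ (con 1 :+ a) :+ (con 1 :+ a)) refl

ballotDefect-one : ∀ a → (suc a + suc a) C a ≡ ballotDefect 1 a + suc (a + a) C a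
ballotDefect-one zero    = refl
ballotDefect-one (suc a) = begin
  (suc (suc a) + suc (suc a)) C suc a   ≡⟨ cong (λ N → suc N C suc a) (+-suc (suc a) (suc a)) ⟩
  suc K C suc a                         ≡⟨ pascal K a ⟩
  K C a + K C suc a                     ∎
  where
  open ≡-Reasoning
  K = suc (suc a + suc a)

ballot+defect≡C : ∀ h a → ballot h a + ballotDefect h a ≡ (h + a + a) C a
ballot+defect≡C h       zero    = refl
ballot+defect≡C zero    (suc a) = begin
  ballot 1 a + (suc a + suc a) C a             ≡⟨ cong (_+_ (ballot 1 a)) (ballotDefect-one a) ⟩
  ballot 1 a + (ballotDefect 1 a + K C a)      ≡⟨ sym (+-assoc (ballot 1 a) _ _) ⟩
  ballot 1 a + ballotDefect 1 a + K C a        ≡⟨ cong (_+ K C a) (ballot+defect≡C 1 a) ⟩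
  K C a + K C a                                ≡⟨ cong (_+_ (K C a)) (sym ([m+n]Cm≡[m+n]Cn (suc a) a)) ⟩
  K C a + K C suc a                            ≡⟨ sym (pascal K a) ⟩
  suc K C suc a                                ≡⟨ cong (λ N → suc N C suc a) (sym (+-suc a a)) ⟩
  (suc a + suc a) C suc a                      ∎
  where
  open ≡-Reasoning
  K = suc (a + a)
ballot+defect≡C (suc h) (suc a) = begin
  ballot (suc h) (suc a) + ballotDefect (suc h) (suc a)   ≡⟨ cong (_+_ (ballot (suc h) (suc a))) (ballotDefect-suc h a) ⟩
  (b₁ + b₂) + (d₁ + d₂)                                   ≡⟨ ℕ+.interchange b₁ b₂ d₁ d₂ ⟩
  (b₁ + d₁) + (b₂ + d₂)                                   ≡⟨ cong₂ _+_ (ballot+defect≡C (suc (suc h)) a) (ballot+defect≡C h (suc a)) ⟩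
  (suc (suc h) + a + a) C a + L C suc a                  ≡⟨ cong (λ N → N C a + L C suc a) (shift h a) ⟩
  L C a + L C suc a                                       ≡⟨ sym (pascal L a) ⟩
  suc L C suc a                                           ∎
  where
  open ≡-Reasoning
  b₁ = ballot (suc (suc h)) a
  b₂ = ballot h (suc a)
  d₁ = ballotDefect (suc (suc h)) a
  d₂ = ballotDefect h (suc a)
  L  = h + suc a + suc a
  shift : ∀ h a → suc (suc h) + a + a ≡ h + suc a + suc a
  shift = solve 2 (λ h a → con 2 :+ h :+ a :+ a := h :+ (con 1 :+ a) :+ (con 1 :+ a)) refl

[n+n]Cn≡ballot0n*[1+n] : ∀ n → (n + n) C n ≡ ballot 0 n * suc n
[n+n]Cn≡ballot0n*[1+n] zero    = refl
[n+n]Cn≡ballot0n*[1+n] (suc k) = begin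
  (n + n) C n   ≡⟨ sym (ballot+defect≡C 0 n) ⟩
  b + d         ≡⟨ cong (_+_ b) (sym n*b≡d) ⟩
  b + n * b     ≡⟨ *-comm (suc n) b ⟩
  b * suc n     ∎
  where
  open ≡-Reasoning
  n = suc k
  b = ballot 0 n
  d = ballotDefect 0 n
  n*b≡d : n * b ≡ d
  n*b≡d = +-cancelʳ-≡ (n * d) (n * b) d (begin
    n * b + n * d   ≡⟨ sym (*-distribˡ-+ n b d) ⟩
    n * (b + d)     ≡⟨ cong (n *_) (ballot+defect≡C 0 n) ⟩
    n * ((n + n) C n) ≡⟨ [1+k]*[2+2k]C[1+k]≡[2+k]*[2+2k]Ck k ⟩
    d + n * d       ∎)

catalan≡ballot : ∀ n → catalan n ≡ ballot 0 n
catalan≡ballot n = begin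
  ((2 * n) C n) / suc n         ≡⟨ cong (λ N → ((n + N) C n) / suc n) (+-identityʳ n) ⟩
  ((n + n) C n) / suc n         ≡⟨ cong (_/ suc n) ([n+n]Cn≡ballot0n*[1+n] n) ⟩
  ballot 0 n * suc n / suc n    ≡⟨ m*n/n≡m (ballot 0 n) (suc n) ⟩
  ballot 0 n                    ∎
  where open ≡-Reasoning

Compositions : ℕ → ℕ → Set
Compositions a s = Σ (Vec ℕ (suc a)) λ v → sum v ≡ s

compositions-≡ : ∀ {a s} {v w : Vec ℕ (suc a)} {p : sum v ≡ s} {q : sum w ≡ s} →
                 v ≡ w → _≡_ {A = Compositions a s} (v , p) (w , q)
compositions-≡ {v = v} {p = p} {q} refl = cong (v ,_) (≡-irrelevant p q)

compositions-single : ∀ s → Compositions 0 s ↔ Fin 1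
compositions-single s = mk↔ₛ′ (λ _ → Fin.zero) (λ _ → (s ∷ []) , +-identityʳ s)
  (λ { Fin.zero → refl ; (Fin.suc ()) }) unique
  where
  unique : ∀ c → ((s ∷ []) , +-identityʳ s) ≡ c
  unique ((x ∷ []) , x+0≡s) = compositions-≡ (cong (_∷ []) (trans (sym x+0≡s) (+-identityʳ x)))

compositions-zero : ∀ a → Compositions (suc a) 0 ↔ Compositions a 0
compositions-zero a = mk↔ₛ′ to from (λ _ → compositions-≡ refl) from∘to
  where
  to : Compositions (suc a) 0 → Compositions a 0
  to ((zero ∷ v) , p) = v , p
  from : Compositions a 0 → Compositions (suc a) 0
  from (v , p) = (0 ∷ v) , p
  from∘to : ∀ c → from (to c) ≡ c
  from∘to ((zero ∷ v) , p) = compositions-≡ refl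

compositions-split : ∀ a s → Compositions (suc a) (suc s) ↔ (Compositions a (suc s) ⊎ Compositions (suc a) s)
compositions-split a s = mk↔ₛ′ to from to∘from from∘to
  where
  to : Compositions (suc a) (suc s) → Compositions a (suc s) ⊎ Compositions (suc a) s
  to ((zero  ∷ v) , p) = inj₁ (v , p)
  to ((suc x ∷ v) , p) = inj₂ ((x ∷ v) , suc-injective p)
  from : Compositions a (suc s) ⊎ Compositions (suc a) s → Compositions (suc a) (suc s)
  from (inj₁ (v , p))       = (0 ∷ v) , p
  from (inj₂ ((x ∷ v) , p)) = (suc x ∷ v) , cong suc p
  to∘from : ∀ c → to (from c) ≡ c
  to∘from (inj₁ _)             = cong inj₁ (compositions-≡ refl)
  to∘from (inj₂ ((_ ∷ _) , _)) = cong inj₂ (compositions-≡ refl)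
  from∘to : ∀ c → from (to c) ≡ c
  from∘to ((zero  ∷ _) , _) = compositions-≡ refl
  from∘to ((suc _ ∷ _) , _) = compositions-≡ refl

compositions↔Fin : ∀ a s → Compositions a s ↔ Fin ((a + s) C a)
compositions↔Fin zero    s       = compositions-single s
compositions↔Fin (suc a) zero    = subst (λ k → Compositions (suc a) 0 ↔ Fin k) count
  (↔-trans (compositions-zero a) (compositions↔Fin a 0))
  where
  count : (a + 0) C a ≡ (suc a + 0) C suc a
  count = trans ([n+0]Cn≡1 a) (sym ([n+0]Cn≡1 (suc a)))
    where
    [n+0]Cn≡1 : ∀ n → (n + 0) C n ≡ 1
    [n+0]Cn≡1 n = trans (cong (_C n) (+-identityʳ n)) (nCn≡1 n)
compositions↔Fin (suc a) (suc s) = subst (λ k → Compositions (suc a) (suc s) ↔ Fin k) count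
  (↔-trans (compositions-split a s)
  (↔-trans (compositions↔Fin a (suc s) ⊎-↔ compositions↔Fin (suc a) s) (↔-sym +↔⊎)))
  where
  count : (a + suc s) C a + (suc a + s) C suc a ≡ (suc a + suc s) C suc a
  count = begin
    (a + suc s) C a + (suc a + s) C suc a       ≡⟨ cong (λ N → (a + suc s) C a + N C suc a) (sym (+-suc a s)) ⟩
    (a + suc s) C a + (a + suc s) C suc a       ≡⟨ sym (pascal (a + suc s) a) ⟩
    (suc a + suc s) C suc a                     ∎
    where open ≡-Reasoning

-- z is read as the walk with steps 1 − zᵢ from height h, which must stay ≥ 1;
-- in BallotSequences h a the sum h + a makes it end at height 1.
StaysPositive : ℕ → ∀ {k} → Vec ℕ k → Set
StaysPositive h []      = ⊤
StaysPositive h (z ∷ v) = z ≤ h × StaysPositive (suc (h ∸ z)) v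

StaysPositive-irrelevant : ∀ h {k} (v : Vec ℕ k) → Irrelevant (StaysPositive h v)
StaysPositive-irrelevant h []      tt       tt         = refl
StaysPositive-irrelevant h (z ∷ v) (p , ps) (q , qs) =
  cong₂ _,_ (≤-irrelevant p q) (StaysPositive-irrelevant (suc (h ∸ z)) v ps qs)

BallotSequences : ℕ → ℕ → Set
BallotSequences h a = Σ (Vec ℕ (suc a)) λ v → sum v ≡ h + a × StaysPositive h v

ballotSequences-≡ : ∀ {h a} {v w : Vec ℕ (suc a)} {p : sum v ≡ h + a × StaysPositive h v}
                    {q : sum w ≡ h + a × StaysPositive h w} →
                    v ≡ w → _≡_ {A = BallotSequences h a} (v , p) (w , q)
ballotSequences-≡ {h} {v = v} {p = p , ps} {q , qs} refl =
  cong (v ,_) (cong₂ _,_ (≡-irrelevant p q) (StaysPositive-irrelevant h v ps qs))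

ballotSequences-single : ∀ h → BallotSequences h 0 ↔ Fin 1
ballotSequences-single h = mk↔ₛ′ (λ _ → Fin.zero) (λ _ → (h ∷ []) , refl , ≤-refl , tt)
  (λ { Fin.zero → refl ; (Fin.suc ()) }) unique
  where
  unique : ∀ b → ((h ∷ []) , refl , ≤-refl , tt) ≡ b
  unique ((z ∷ []) , z+0≡h+0 , _) = ballotSequences-≡ (cong (_∷ []) (+-cancelʳ-≡ 0 h z (sym z+0≡h+0)))

ballotSequences-zero : ∀ a → BallotSequences 0 (suc a) ↔ BallotSequences 1 a
ballotSequences-zero a = mk↔ₛ′ to from (λ _ → ballotSequences-≡ refl) from∘to
  where
  to : BallotSequences 0 (suc a) → BallotSequences 1 a
  to ((zero ∷ v) , p , _ , ps) = v , p , ps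
  from : BallotSequences 1 a → BallotSequences 0 (suc a)
  from (v , p , ps) = (0 ∷ v) , p , z≤n , ps
  from∘to : ∀ b → from (to b) ≡ b
  from∘to ((zero ∷ _) , _) = ballotSequences-≡ refl

ballotSequences-split : ∀ h a →
  BallotSequences (suc h) (suc a) ↔ (BallotSequences (suc (suc h)) a ⊎ BallotSequences h (suc a))
ballotSequences-split h a = mk↔ₛ′ to from to∘from from∘to
  where
  to : BallotSequences (suc h) (suc a) → BallotSequences (suc (suc h)) a ⊎ BallotSequences h (suc a)
  to ((zero  ∷ v) , p , _ , ps)   = inj₁ (v , trans p (cong suc (+-suc h a)) , ps)
  to ((suc z ∷ v) , p , z<h , ps) = inj₂ ((z ∷ v) , suc-injective p , s≤s⁻¹ z<h , ps)
  from : BallotSequences (suc (suc h)) a ⊎ BallotSequences h (suc a) → BallotSequences (suc h) (suc a)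
  from (inj₁ (v , p , ps))             = (0 ∷ v) , trans p (cong suc (sym (+-suc h a))) , z≤n , ps
  from (inj₂ ((z ∷ v) , p , z≤h , ps)) = (suc z ∷ v) , cong suc p , s≤s z≤h , ps
  to∘from : ∀ b → to (from b) ≡ b
  to∘from (inj₁ _)             = cong inj₁ (ballotSequences-≡ refl)
  to∘from (inj₂ ((_ ∷ _) , _)) = cong inj₂ (ballotSequences-≡ refl)
  from∘to : ∀ b → from (to b) ≡ b
  from∘to ((zero  ∷ _) , _) = ballotSequences-≡ refl
  from∘to ((suc _ ∷ _) , _) = ballotSequences-≡ refl

ballotSequences↔Fin : ∀ h a → BallotSequences h a ↔ Fin (ballot h a)
ballotSequences↔Fin h       zero    = ballotSequences-single h
ballotSequences↔Fin zero    (suc a) = ↔-trans (ballotSequences-zero a) (ballotSequences↔Fin 1 a)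
ballotSequences↔Fin (suc h) (suc a) = ↔-trans (ballotSequences-split h a)
  (↔-trans (ballotSequences↔Fin (suc (suc h)) a ⊎-↔ ballotSequences↔Fin h (suc a)) (↔-sym +↔⊎))

-- A lattice path is encoded by aᵢ = xᵢ − 1 and zᵢ = 1 − yᵢ, both natural numbers.
step : ℕ → ℕ → ℤ × ℤ
step a z = + suc a , 1 ⊖ z

encode : ∀ {k} → Vec ℕ k → Vec ℕ k → Vec (ℤ × ℤ) k
encode = zipWith step

-- Inverses of step on x ≥ 1 and y ≤ 1; the other values are junk.
unstepX : ℤ → ℕ
unstepX (+ suc a) = a
unstepX _         = 0

unstepY : ℤ → ℕ
unstepY (+ zero)  = 1
unstepY (+ suc _) = 0
unstepY -[1+ k ]  = suc (suc k)

decodeX decodeY : ∀ {k} → Vec (ℤ × ℤ) k → Vec ℕ k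
decodeX = map (unstepX ∘ proj₁)
decodeY = map (unstepY ∘ proj₂)

unstepY-step : ∀ z → unstepY (1 ⊖ z) ≡ z
unstepY-step zero          = refl
unstepY-step (suc zero)    = refl
unstepY-step (suc (suc z)) = refl

step-unstep : ∀ {x y} → + 1 ℤ.≤ x → y ℤ.≤ + 1 → step (unstepX x) (unstepY y) ≡ (x , y)
step-unstep {y = + zero}        (+≤+ (s≤s z≤n)) _ = refl
step-unstep {y = + suc zero}    (+≤+ (s≤s z≤n)) _ = refl
step-unstep {y = -[1+ _ ]}      (+≤+ (s≤s z≤n)) _ = refl
step-unstep {y = + suc (suc _)} _ (+≤+ (s≤s ()))

decodeX-encode : ∀ {k} (a z : Vec ℕ k) → decodeX (encode a z) ≡ a
decodeX-encode []       []       = refl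
decodeX-encode (a ∷ as) (z ∷ zs) = cong (a ∷_) (decodeX-encode as zs)

decodeY-encode : ∀ {k} (a z : Vec ℕ k) → decodeY (encode a z) ≡ z
decodeY-encode []       []       = refl
decodeY-encode (a ∷ as) (z ∷ zs) = cong₂ _∷_ (unstepY-step z) (decodeY-encode as zs)

encode-decode : ∀ {n m k} {P : Vec (ℤ × ℤ) k} → All (EntryOK n m) P → encode (decodeX P) (decodeY P) ≡ P
encode-decode []                                          = refl
encode-decode {n} {m} (((_ , y≤1) , (1≤x , _)) ∷ entries) =
  cong₂ _∷_ (step-unstep 1≤x y≤1) (encode-decode {n} {m} entries)

sumX-encode : ∀ {k} (a z : Vec ℕ k) → sumX (encode a z) ≡ + (k + sum a)
sumX-encode []       []       = refl
sumX-encode {suc k} (a ∷ as) (z ∷ zs) =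
  trans (cong (λ s → + suc a ℤ.+ s) (sumX-encode as zs)) (cong (+_ ∘ suc) (ℕ+.x∙yz≈y∙xz a k (sum as)))

1⊖z+z≡1 : ∀ z → (1 ⊖ z) ℤ.+ + z ≡ + 1
1⊖z+z≡1 z = begin
  (1 ⊖ z) ℤ.+ + z     ≡⟨ ℤ.distribˡ-⊖-+-pos z 1 z ⟩
  suc z ⊖ z           ≡⟨ ℤ.⊖-≥ (n≤1+n z) ⟩
  + (suc z ∸ z)       ≡⟨ cong +_ (m+n∸n≡m 1 z) ⟩
  + 1                 ∎
  where open ≡-Reasoning

sumY-encode : ∀ {k} (a z : Vec ℕ k) → sumY (encode a z) ℤ.+ + sum z ≡ + k
sumY-encode []       []       = refl
sumY-encode {suc k} (a ∷ as) (z ∷ zs) = begin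
  ((1 ⊖ z) ℤ.+ S) ℤ.+ (+ z ℤ.+ + sum zs)   ≡⟨ ℤ+.interchange (1 ⊖ z) S (+ z) (+ sum zs) ⟩
  ((1 ⊖ z) ℤ.+ + z) ℤ.+ (S ℤ.+ + sum zs)   ≡⟨ cong₂ ℤ._+_ (1⊖z+z≡1 z) (sumY-encode as zs) ⟩
  + suc k                                   ∎
  where
  open ≡-Reasoning
  S = sumY (encode as zs)

XNonnegative : ℤ × ℤ → Set
XNonnegative (x , _) = + 0 ℤ.≤ x

nplFrom-nonnegative : ∀ {k} acc {P : Vec (ℤ × ℤ) k} → All XNonnegative P → + 0 ℤ.≤ nplFrom acc P
nplFrom-nonnegative acc []                         = ℤ.≤-refl
nplFrom-nonnegative acc {(x , y) ∷ P} (x≥0 ∷ xs≥0) =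
  ℤ.+-mono-≤ (selected (does (acc ℤ.+ y ℤ.≤? + 0))) (nplFrom-nonnegative (acc ℤ.+ y) xs≥0)
  where
  selected : ∀ b → + 0 ℤ.≤ (if b then x else + 0)
  selected true  = x≥0
  selected false = ℤ.≤-refl

encode-XNonnegative : ∀ {k} (a z : Vec ℕ k) → All XNonnegative (encode a z)
encode-XNonnegative []       []       = []
encode-XNonnegative (a ∷ as) (z ∷ zs) = +≤+ z≤n ∷ encode-XNonnegative as zs

+h+[1⊖z]≡[1+h]⊖z : ∀ h z → + h ℤ.+ (1 ⊖ z) ≡ suc h ⊖ z
+h+[1⊖z]≡[1+h]⊖z h z = trans (ℤ.distribʳ-⊖-+-pos h 1 z) (cong (_⊖ z) (+-comm h 1))

height-step-positive : ∀ {h z} → z ≤ h → + h ℤ.+ (1 ⊖ z) ≡ + suc (h ∸ z)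
height-step-positive {h} {z} z≤h = begin
  + h ℤ.+ (1 ⊖ z)   ≡⟨ +h+[1⊖z]≡[1+h]⊖z h z ⟩
  suc h ⊖ z         ≡⟨ ℤ.⊖-≥ (m≤n⇒m≤1+n z≤h) ⟩
  + (suc h ∸ z)     ≡⟨ cong +_ (+-∸-assoc 1 z≤h) ⟩
  + suc (h ∸ z)     ∎
  where open ≡-Reasoning

height-step-nonpositive : ∀ {h z} → h < z → + h ℤ.+ (1 ⊖ z) ℤ.≤ + 0
height-step-nonpositive {h} {z} h<z =
  subst (ℤ._≤ + 0) (sym (trans (+h+[1⊖z]≡[1+h]⊖z h z) (ℤ.⊖-≤ h<z))) ℤ.neg-≤-pos

nplFrom-step-≤ : ∀ {k h z} a (P : Vec (ℤ × ℤ) k) → z ≤ h →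
                 nplFrom (+ h) (step a z ∷ P) ≡ nplFrom (+ suc (h ∸ z)) P
nplFrom-step-≤ a P z≤h rewrite height-step-positive z≤h = ℤ.+-identityˡ _

nplFrom-step->-≢0 : ∀ {k h z} a {P : Vec (ℤ × ℤ) k} → h < z → All XNonnegative P →
                    nplFrom (+ h) (step a z ∷ P) ≢ + 0
nplFrom-step->-≢0 {h = h} {z} a {P} h<z xs≥0
  rewrite dec-true (+ h ℤ.+ (1 ⊖ z) ℤ.≤? + 0) (height-step-nonpositive h<z)
  with nplFrom (+ h ℤ.+ (1 ⊖ z)) P | nplFrom-nonnegative (+ h ℤ.+ (1 ⊖ z)) xs≥0
... | + _ | _ = λ ()

StaysPositive⇒nplFrom≡0 : ∀ h {k} (a z : Vec ℕ k) → StaysPositive h z → nplFrom (+ h) (encode a z) ≡ + 0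
StaysPositive⇒nplFrom≡0 h []       []       _           = refl
StaysPositive⇒nplFrom≡0 h (a ∷ as) (z ∷ zs) (z≤h , pos) =
  trans (nplFrom-step-≤ a (encode as zs) z≤h) (StaysPositive⇒nplFrom≡0 (suc (h ∸ z)) as zs pos)

nplFrom≡0⇒StaysPositive : ∀ h {k} (a z : Vec ℕ k) → nplFrom (+ h) (encode a z) ≡ + 0 → StaysPositive h z
nplFrom≡0⇒StaysPositive h []       []       _ = _
nplFrom≡0⇒StaysPositive h (a ∷ as) (z ∷ zs) eq with z ≤? h
... | yes z≤h = z≤h , nplFrom≡0⇒StaysPositive (suc (h ∸ z)) as zs (trans (sym (nplFrom-step-≤ a (encode as zs) z≤h)) eq)
... | no  z≰h = ⊥-elim (nplFrom-step->-≢0 a (≰⇒> z≰h) (encode-XNonnegative as zs) eq)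

step-EntryOK : ∀ {n m a z} → z ≤ n → 2 + a ≤ m → EntryOK n m (step a z)
step-EntryOK {n} {z = z} z≤n′ (s≤s 1+a≤m-1) =
  (lower , ℤ.m⊖n≤m 1 z) , (+≤+ (s≤s z≤n) , +≤+ 1+a≤m-1)
  where
  lower : + 1 ℤ.- + n ℤ.≤ 1 ⊖ z
  lower = subst (ℤ._≤ 1 ⊖ z) (sym (ℤ.[+m]-[+n]≡m⊖n 1 n)) (ℤ.⊖-monoʳ-≥-≤ 1 {n} {z} z≤n′)

encode-EntryOK : ∀ {n m k} (a z : Vec ℕ k) → 2 + sum a ≤ m → sum z ≤ n → All (EntryOK n m) (encode a z)
encode-EntryOK []       []       _   _   = []
encode-EntryOK (a ∷ as) (z ∷ zs) 2+Σa≤m Σz≤n =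
  step-EntryOK (≤-trans (m≤m+n z (sum zs)) Σz≤n) (≤-trans (+-monoʳ-≤ 2 (m≤m+n a (sum as))) 2+Σa≤m)
  ∷ encode-EntryOK as zs (≤-trans (+-monoʳ-≤ 2 (m≤n+m (sum as) a)) 2+Σa≤m) (≤-trans (m≤n+m (sum zs) z) Σz≤n)

sumX-encode≡⇒ : ∀ {n m} (a z : Vec ℕ (suc n)) → sumX (encode a z) ≡ + m → sum a ≡ m ∸ suc n
sumX-encode≡⇒ {n} a z eq =
  trans (sym (m+n∸m≡n (suc n) (sum a))) (cong (_∸ suc n) (ℤ.+-injective (trans (sym (sumX-encode a z)) eq)))

sumY-encode≡1⇒ : ∀ {n} (a z : Vec ℕ (suc n)) → sumY (encode a z) ≡ + 1 → sum z ≡ n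
sumY-encode≡1⇒ a z eq =
  suc-injective (ℤ.+-injective (trans (sym (cong (ℤ._+ + sum z) eq)) (sumY-encode a z)))

sumY-encode≡1⇐ : ∀ {n} (a z : Vec ℕ (suc n)) → sum z ≡ n → sumY (encode a z) ≡ + 1
sumY-encode≡1⇐ {n} a z eq =
  ℤ+-group.∙-cancelʳ (+ n) _ _ (subst (λ s → sumY (encode a z) ℤ.+ + s ≡ + suc n) eq (sumY-encode a z))

All-last : ∀ {A : Set} {Q : A → Set} {k} {v : Vec A (suc k)} → All Q v → Q (last v)
All-last {v = _ ∷ []}     (q ∷ []) = q
All-last {v = _ ∷ _ ∷ _} (_ ∷ qs) = All-last qs

≡ℤ-irrelevant : ∀ {i j : ℤ} → Irrelevant (i ≡ j)
≡ℤ-irrelevant = Decidable⇒UIP.≡-irrelevant ℤ._≟_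

EntryOK-irrelevant : ∀ {n m e} → Irrelevant (EntryOK n m e)
EntryOK-irrelevant ((a , b) , (c , d)) ((a′ , b′) , (c′ , d′)) =
  cong₂ _,_ (cong₂ _,_ (ℤ.≤-irrelevant a a′) (ℤ.≤-irrelevant b b′))
            (cong₂ _,_ (ℤ.≤-irrelevant c c′) (ℤ.≤-irrelevant d d′))

IsLatticePath-irrelevant : ∀ {n m P} → Irrelevant (IsLatticePath n m P)
IsLatticePath-irrelevant {n} {m} (e , y , x) (e′ , y′ , x′) =
  cong₂ _,_ (All.irrelevant (EntryOK-irrelevant {n} {m}) e e′) (cong₂ _,_ (≡ℤ-irrelevant y y′) (≡ℤ-irrelevant x x′))

nonnegative-sum≡0 : ∀ {i j} → + 0 ℤ.≤ i → + 0 ℤ.≤ j → i ℤ.+ j ≡ + 0 → i ≡ + 0 × j ≡ + 0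
nonnegative-sum≡0 {+ a} {+ b} _ _ eq =
  cong +_ (m+n≡0⇒m≡0 a (ℤ.+-injective eq)) , cong +_ (m+n≡0⇒n≡0 a (ℤ.+-injective eq))

LatticePathNPL0 : ℕ → ℕ → Set
LatticePathNPL0 n m = Σ (Seq n) λ P → IsLatticePath n m P × NPL P ≡ + 0

latticePathNPL0-≡ : ∀ {n m} {P P′ : Seq n} {p : IsLatticePath n m P × NPL P ≡ + 0}
                    {p′ : IsLatticePath n m P′ × NPL P′ ≡ + 0} →
                    P ≡ P′ → _≡_ {A = LatticePathNPL0 n m} (P , p) (P′ , p′)
latticePathNPL0-≡ {P = P} {p = L , e} {L′ , e′} refl =
  cong (P ,_) (cong₂ _,_ (IsLatticePath-irrelevant L L′) (≡ℤ-irrelevant e e′))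

pointedPathPNPL0↔latticePathNPL0 : ∀ n m → PointedPathPNPL0 n m ↔ LatticePathNPL0 n m
pointedPathPNPL0↔latticePathNPL0 n m = mk↔ₛ′ to from (λ _ → latticePathNPL0-≡ refl) from∘to
  where
  path-XNonnegative : ∀ {P : Seq n} → IsLatticePath n m P → All XNonnegative P
  path-XNonnegative (entries , _) = All.map (λ (_ , (1≤x , _)) → ℤ.≤-trans (+≤+ z≤n) 1≤x) entries
  pointing≡0 : ∀ {P j} → IsLatticePath n m P → + 0 ℤ.≤ j → NPL P ℤ.+ j ≡ + 0 → NPL P ≡ + 0 × j ≡ + 0
  pointing≡0 L j≥0 = nonnegative-sum≡0 (nplFrom-nonnegative (+ 0) (path-XNonnegative L)) j≥0
  to : PointedPathPNPL0 n m → LatticePathNPL0 n m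
  to ((P , L , j , (j≥0 , _)) , e) = P , L , proj₁ (pointing≡0 L j≥0 e)
  from : LatticePathNPL0 n m → PointedPathPNPL0 n m
  from (P , L@(entries , _) , e) =
    (P , L , + 0 , ℤ.≤-refl , ℤ.i≤j⇒0≤j-i (proj₁ (proj₂ (All-last entries)))) , trans (ℤ.+-identityʳ _) e
  from∘to : ∀ p → from (to p) ≡ p
  from∘to ((P , L , j , (j≥0 , j≤)) , e) with proj₂ (pointing≡0 L j≥0 e)
  ... | refl = cong₂ (λ b e → (P , L , + 0 , b) , e)
    (cong₂ _,_ (ℤ.≤-irrelevant _ j≥0) (ℤ.≤-irrelevant _ j≤)) (≡ℤ-irrelevant _ e)

latticePathNPL0↔compositions×ballotSequences : ∀ {n m} → 1 ≤ n → suc n ≤ m →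
  LatticePathNPL0 n m ↔ (Compositions n (m ∸ suc n) × BallotSequences 0 n)
latticePathNPL0↔compositions×ballotSequences {n} {m} 1≤n n<m = mk↔ₛ′ to from to∘from from∘to
  where
  to : LatticePathNPL0 n m → Compositions n (m ∸ suc n) × BallotSequences 0 n
  to (P , (entries , sumY≡1 , sumX≡m) , NPL≡0) =
    (a , sumX-encode≡⇒ a z (trans (cong sumX P≡) sumX≡m)) ,
    (z , sumY-encode≡1⇒ a z (trans (cong sumY P≡) sumY≡1) ,
         nplFrom≡0⇒StaysPositive 0 a z (trans (cong NPL P≡) NPL≡0))
    where
    a = decodeX P
    z = decodeY P
    P≡ : encode a z ≡ P
    P≡ = encode-decode {n} {m} entries
  -- The only use of 1 ≤ n: it makes the bound xᵢ ≤ m − 1 automatic.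
  2+Σa≤m : ∀ {s} → s ≡ m ∸ suc n → 2 + s ≤ m
  2+Σa≤m refl = ≤-trans (+-monoˡ-≤ (m ∸ suc n) (s≤s 1≤n)) (≤-reflexive (m+[n∸m]≡n n<m))
  from : Compositions n (m ∸ suc n) × BallotSequences 0 n → LatticePathNPL0 n m
  from ((a , Σa) , (z , Σz , positive)) =
    encode a z ,
    (encode-EntryOK a z (2+Σa≤m Σa) (≤-reflexive Σz) ,
     sumY-encode≡1⇐ a z Σz ,
     trans (sumX-encode a z) (cong +_ (trans (cong (λ s → suc n + s) Σa) (m+[n∸m]≡n n<m)))) ,
    StaysPositive⇒nplFrom≡0 0 a z positive
  to∘from : ∀ c → to (from c) ≡ c
  to∘from ((a , _) , (z , _)) = cong₂ _,_ (compositions-≡ (decodeX-encode a z)) (ballotSequences-≡ (decodeY-encode a z))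
  from∘to : ∀ p → from (to p) ≡ p
  from∘to (P , (entries , _) , _) = latticePathNPL0-≡ (encode-decode {n} {m} entries)

lemma3p3 : (n m : ℕ) → 1 ≤ n → n + 1 ≤ m →
    PointedPathPNPL0 n m ↔ Fin (((m ∸ 1) C n) * catalan n)
lemma3p3 n m 1≤n n+1≤m = begin
  PointedPathPNPL0 n m                                ↔⟨ pointedPathPNPL0↔latticePathNPL0 n m ⟩
  LatticePathNPL0 n m                                 ↔⟨ latticePathNPL0↔compositions×ballotSequences 1≤n n<m ⟩
  (Compositions n (m ∸ suc n) × BallotSequences 0 n)  ↔⟨ compositions↔Fin n (m ∸ suc n) ×-↔ ballotSequences↔Fin 0 n ⟩
  (Fin ((n + (m ∸ suc n)) C n) × Fin (ballot 0 n))    ↔⟨ *↔× ⟨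
  Fin (((n + (m ∸ suc n)) C n) * ballot 0 n)          ≡⟨ cong Fin (cong₂ _*_ (cong (_C n) parts) (sym (catalan≡ballot n))) ⟩
  Fin (((m ∸ 1) C n) * catalan n)                     ∎
  where
  open EquationalReasoning
  n<m : suc n ≤ m
  n<m = subst (_≤ m) (+-comm n 1) n+1≤m
  parts : n + (m ∸ suc n) ≡ m ∸ 1
  parts with s≤s n≤m-1 ← n<m = m+[n∸m]≡n n≤m-1
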